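{- Let $n$ and $m$ be integers with $n\geq 3$ and $m\geq 3$, and let $P_n$, $P_m$ denote the paths on $n$ and $m$ vertices. Then $\tau_3(P_n\Box P_m)=0$; that is, there exist three vertices of the grid $P_n\Box P_m$ for which no pendant Steiner tree connecting them exists.
   Context: All graphs are finite, simple and undirected. For a graph $G$ and a set $S\subseteq V(G)$ with $|S|\geq 2$, an $S$-Steiner tree is a subgraph $T$ of $G$ that is a tree with $S\subseteq V(T)$. A pendant $S$-Steiner tree is an $S$-Steiner tree in which every vertex of $S$ has degree exactly $1$. Two pendant $S$-Steiner trees $T,T'$ are internally disjoint if $E(T)\cap E(T')=\varnothing$ and $V(T)\cap V(T')=S$. The local pendant tree-connectivity $\tau_G(S)$ is the maximum number of pairwise internally disjoint pendant $S$-Steiner trees in $G$. For a graph $G$ of order $n$ and $2\le k\le n$, $\tau_k(G)=\min\{\tau_G(S): S\subseteq V(G),\ |S|=k\}$. The Cartesian product $G\Box H$ has vertex set $V(G)\times V(H)$, with $(u,v)$ adjacent to $(u',v')$ iff either $u=u'$ and $vv'\in E(H)$, or $v=v'$ and $uu'\in E(G)$. -}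

module Defs where

open import Level using (0ℓ)
open import Data.Nat using (ℕ; zero; suc; _+_; _≤_; _≥_)
open import Data.Fin using (Fin; toℕ)
open import Data.Product using (Σ; ∃; _×_; _,_)
open import Data.Sum using (_⊎_)
open import Data.Empty using (⊥)
open import Data.List using (List; []; _∷_; length; last)
open import Data.Maybe using (just)
open import Data.List.Membership.Propositional using (_∈_)
open import Data.List.Relation.Unary.All using (All)
open import Data.List.Relation.Unary.Linked using (Linked)
open import Data.List.Relation.Unary.Unique.Propositional using (Unique)
open import Relation.Nullary using (¬_)
open import Relation.Binary.PropositionalEquality using (_≡_; _≢_)

record Graph : Set₁ where
  field
    V      : Set
    _~_    : V → V → Set
    ~-sym  : ∀ {u v} → u ~ v → v ~ u
    ~-irr  : ∀ {u} → ¬ (u ~ u)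
open Graph public

PathAdj : (n : ℕ) → Fin n → Fin n → Set
PathAdj n i j = (suc (toℕ i) ≡ toℕ j) ⊎ (suc (toℕ j) ≡ toℕ i)

private
  suc≢ : ∀ k → suc k ≡ k → ⊥
  suc≢ zero ()
  suc≢ (suc k) p = suc≢ k (cong-pred p)
    where
    cong-pred : ∀ {a b} → suc a ≡ suc b → a ≡ b
    cong-pred _≡_.refl = _≡_.refl

  path-sym : ∀ {n} {i j : Fin n} → PathAdj n i j → PathAdj n j i
  path-sym (Data.Sum.inj₁ p) = Data.Sum.inj₂ p
  path-sym (Data.Sum.inj₂ p) = Data.Sum.inj₁ p

  path-irr : ∀ {n} {i : Fin n} → ¬ PathAdj n i i
  path-irr {i = i} (Data.Sum.inj₁ p) = suc≢ (toℕ i) p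
  path-irr {i = i} (Data.Sum.inj₂ p) = suc≢ (toℕ i) p

Path : ℕ → Graph
Path n = record
  { V = Fin n ; _~_ = PathAdj n ; ~-sym = path-sym ; ~-irr = path-irr }

module _ (G H : Graph) where
  private
    module G = Graph G
    module H = Graph H

  BoxAdj : G.V × H.V → G.V × H.V → Set
  BoxAdj (u , v) (u' , v') = ((u ≡ u') × (v H.~ v')) ⊎ ((v ≡ v') × (u G.~ u'))

  private
    box-sym : ∀ {x y} → BoxAdj x y → BoxAdj y x
    box-sym (Data.Sum.inj₁ (_≡_.refl , a)) = Data.Sum.inj₁ (_≡_.refl , H.~-sym a)
    box-sym (Data.Sum.inj₂ (_≡_.refl , a)) = Data.Sum.inj₂ (_≡_.refl , G.~-sym a)

    box-irr : ∀ {x} → ¬ BoxAdj x x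
    box-irr (Data.Sum.inj₁ (_ , a)) = H.~-irr a
    box-irr (Data.Sum.inj₂ (_ , a)) = G.~-irr a

  _□_ : Graph
  _□_ = record { V = G.V × H.V ; _~_ = BoxAdj ; ~-sym = box-sym ; ~-irr = box-irr }

module _ (G : Graph) where
  private
    module G = Graph G

  -- A (finite) subgraph: a list of vertices and a list of edges
  -- (an edge is a pair (u , v), read as the unordered edge uv),
  -- every edge being an edge of G with both ends among the vertices.
  record Subgraph : Set where
    field
      verts    : List G.V
      edges    : List (G.V × G.V)
      edges-ok : All (λ e → Σ G.V λ u → Σ G.V λ v →
                        (e ≡ (u , v)) × (u ∈ verts) × (v ∈ verts) × (u G.~ v))
                     edges
  open Subgraph public

  SAdj : Subgraph → G.V → G.V → Set
  SAdj T u v = ((u , v) ∈ edges T) ⊎ ((v , u) ∈ edges T)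

  data Walk (T : Subgraph) : G.V → G.V → Set where
    here : ∀ {u} → Walk T u u
    step : ∀ {u v w} → SAdj T u v → Walk T v w → Walk T u w

  Connected : Subgraph → Set
  Connected T = ∀ u v → u ∈ verts T → v ∈ verts T → Walk T u v

  Cycle : Subgraph → Set
  Cycle T = Σ G.V λ x → Σ (List G.V) λ xs → Σ G.V λ y →
              (2 ≤ length xs) × Unique (x ∷ xs) × Linked (SAdj T) (x ∷ xs)
              × (last (x ∷ xs) ≡ just y) × SAdj T y x

  IsTree : Subgraph → Set
  IsTree T = Connected T × ¬ Cycle T

  _⊆V_ : List G.V → Subgraph → Set
  S ⊆V T = All (λ s → s ∈ verts T) S

  Deg1 : Subgraph → G.V → Set
  Deg1 T s = Σ G.V λ w → SAdj T s w × (∀ w' → SAdj T s w' → w' ≡ w)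

  IsPendantSteinerTree : List G.V → Subgraph → Set
  IsPendantSteinerTree S T = IsTree T × S ⊆V T × All (Deg1 T) S

  InternallyDisjoint : List G.V → Subgraph → Subgraph → Set
  InternallyDisjoint S T T' =
    (∀ u v → SAdj T u v → SAdj T' u v → ⊥) ×
    (∀ x → x ∈ verts T → x ∈ verts T' → x ∈ S)

  HasPendantFamily : List G.V → ℕ → Set
  HasPendantFamily S t =
    Σ (Fin t → Subgraph) λ T →
      (∀ i → IsPendantSteinerTree S (T i)) ×
      (∀ i j → i ≢ j → InternallyDisjoint S (T i) (T j))

  IsLocalPendantTau : List G.V → ℕ → Set
  IsLocalPendantTau S t =
    HasPendantFamily S t × (∀ t' → HasPendantFamily S t' → t' ≤ t)

  IsKSubset : ℕ → List G.V → Set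
  IsKSubset k S = Unique S × (length S ≡ k)

  IsPendantTau : ℕ → ℕ → Set
  IsPendantTau k t =
    (Σ (List G.V) λ S → IsKSubset k S × IsLocalPendantTau S t) ×
    (∀ S t' → IsKSubset k S → IsLocalPendantTau S t' → t ≤ t')

module Submission where

-- In the grid P_n □ P_m (n, m ≥ 3) take the corner a = (0,0)
-- and its only two neighbours b = (1,0) and c = (0,1), and S = {a, b, c}.
-- In a pendant S-Steiner tree T the corner a has a single T-neighbour,
-- which must be b or c, i.e. another terminal.  But two adjacent
-- terminals of degree 1 form a closed component {p, q} of T: every walk
-- starting in {p, q} stays there.  So the third terminal is unreachable,
-- contradicting connectivity.

open import Defs
open import Data.Nat using (ℕ; zero; suc; _≤_; _≥_; z≤n; s≤s)
open import Data.Fin using (zero; suc)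
open import Data.Product using (_,_)
open import Data.Sum using (_⊎_; inj₁; inj₂)
open import Data.Empty using (⊥-elim)
open import Data.List using (List; []; _∷_)
open import Data.List.Relation.Unary.All using ([]; _∷_)
import Data.List.Relation.Unary.All as All
open import Data.List.Relation.Unary.AllPairs using ([]; _∷_)
open import Data.List.Membership.Propositional using (_∈_)
open import Relation.Nullary using (¬_)
open import Relation.Binary.PropositionalEquality using (_≡_; refl; sym; trans)

module GeneralFacts (G : Graph) where
  open Graph G using () renaming (V to Vertex; _~_ to _∼_; ~-sym to ∼-sym)

  subgraph-edge : (T : Subgraph G) → ∀ {u v} → SAdj G T u v → u ∼ v
  subgraph-edge T (inj₁ uv∈T) with All.lookup (edges-ok T) uv∈T
  ... | _ , _ , refl , _ , _ , u~v = u~v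
  subgraph-edge T (inj₂ vu∈T) with All.lookup (edges-ok T) vu∈T
  ... | _ , _ , refl , _ , _ , v~u = ∼-sym v~u

  SAdj-sym : (T : Subgraph G) → ∀ {u v} → SAdj G T u v → SAdj G T v u
  SAdj-sym T (inj₁ uv∈T) = inj₂ uv∈T
  SAdj-sym T (inj₂ vu∈T) = inj₁ vu∈T

  walk-trapped : (T : Subgraph G) (p q : Vertex) →
    (∀ x → SAdj G T p x → x ≡ q) → (∀ x → SAdj G T q x → x ≡ p) →
    ∀ {u v} → (u ≡ p) ⊎ (u ≡ q) → Walk G T u v → (v ≡ p) ⊎ (v ≡ q)
  walk-trapped T p q onlyQ onlyP u∈pq here = u∈pq
  walk-trapped T p q onlyQ onlyP (inj₁ refl) (step p~x w) =
    walk-trapped T p q onlyQ onlyP (inj₂ (onlyQ _ p~x)) w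
  walk-trapped T p q onlyQ onlyP (inj₂ refl) (step q~x w) =
    walk-trapped T p q onlyQ onlyP (inj₁ (onlyP _ q~x)) w

  deg1-unique : (T : Subgraph G) → ∀ {p q} → Deg1 G T p → SAdj G T p q →
    ∀ x → SAdj G T p x → x ≡ q
  deg1-unique T (w , _ , onlyW) p~q x p~x = trans (onlyW x p~x) (sym (onlyW _ p~q))

  adjacent-pendants-span : (T : Subgraph G) → Connected G T → ∀ {p q r} →
    p ∈ verts T → r ∈ verts T → Deg1 G T p → Deg1 G T q → SAdj G T p q →
    (r ≡ p) ⊎ (r ≡ q)
  adjacent-pendants-span T conn p∈T r∈T deg-p deg-q p~q =
    walk-trapped T _ _ (deg1-unique T deg-p p~q)
                       (deg1-unique T deg-q (SAdj-sym T p~q))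
                 (inj₁ refl) (conn _ _ p∈T r∈T)

  no-pendant-tree⇒τ≡0 : ∀ k (S : List Vertex) → IsKSubset G k S →
    (∀ T → ¬ IsPendantSteinerTree G S T) → IsPendantTau G k 0
  no-pendant-tree⇒τ≡0 k S kset noTree =
    (S , kset , (empty-family , at-most-0)) , λ _ _ _ _ → z≤n
    where
    empty-family : HasPendantFamily G S 0
    empty-family = (λ ()) , (λ ()) , (λ ())

    at-most-0 : ∀ t → HasPendantFamily G S t → t ≤ 0
    at-most-0 zero _ = z≤n
    at-most-0 (suc t) (T , pendant , _) = ⊥-elim (noTree (T zero) (pendant zero))

module Corner (n m : ℕ) where
  Grid : Graph
  Grid = Path (suc (suc n)) □ Path (suc (suc m))

  open Graph Grid using () renaming (V to Vertex; _~_ to _∼_)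
  open GeneralFacts Grid

  a b c : Vertex
  a = (zero , zero)
  b = (suc zero , zero)
  c = (zero , suc zero)

  terminals : List Vertex
  terminals = a ∷ b ∷ c ∷ []

  terminals-3-set : IsKSubset Grid 3 terminals
  terminals-3-set = (((λ ()) ∷ (λ ()) ∷ []) ∷ ((λ ()) ∷ []) ∷ [] ∷ []) , refl

  corner-neighbours : ∀ {x} → a ∼ x → (x ≡ b) ⊎ (x ≡ c)
  corner-neighbours {_ , suc zero} (inj₁ (refl , inj₁ refl)) = inj₂ refl
  corner-neighbours {_ , zero} (inj₁ (refl , inj₁ ()))
  corner-neighbours {_ , suc (suc _)} (inj₁ (refl , inj₁ ()))
  corner-neighbours (inj₁ (refl , inj₂ ()))
  corner-neighbours {suc zero , _} (inj₂ (refl , inj₁ refl)) = inj₁ refl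
  corner-neighbours {zero , _} (inj₂ (refl , inj₁ ()))
  corner-neighbours {suc (suc _) , _} (inj₂ (refl , inj₁ ()))
  corner-neighbours (inj₂ (refl , inj₂ ()))

  -- The corner's tree-neighbour is b or c; the remaining terminal would
  -- then have to equal a or that neighbour, which it does not.
  no-pendant-tree : ∀ T → ¬ IsPendantSteinerTree Grid terminals T
  no-pendant-tree T ((conn , _) , (a∈T ∷ b∈T ∷ c∈T ∷ []) , (deg-a ∷ deg-b ∷ deg-c ∷ []))
    with deg-a
  ... | (_ , a~w , _) with corner-neighbours (subgraph-edge T a~w)
  ...   | inj₁ refl with adjacent-pendants-span T conn a∈T c∈T deg-a deg-b a~w
  ...     | inj₁ ()
  ...     | inj₂ ()
  no-pendant-tree T ((conn , _) , (a∈T ∷ b∈T ∷ c∈T ∷ []) , (deg-a ∷ deg-b ∷ deg-c ∷ []))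
    | (_ , a~w , _) | inj₂ refl with adjacent-pendants-span T conn a∈T b∈T deg-a deg-c a~w
  ...     | inj₁ ()
  ...     | inj₂ ()

proposition3p4 : (n m : ℕ) → n ≥ 3 → m ≥ 3 →
    IsPendantTau (Path n □ Path m) 3 0
proposition3p4 (suc (suc n)) (suc (suc m)) _ _ =
  GeneralFacts.no-pendant-tree⇒τ≡0 Grid 3 terminals terminals-3-set no-pendant-tree
  where open Corner n m
proposition3p4 (suc zero) _ (s≤s ()) _
proposition3p4 (suc (suc n)) (suc zero) _ (s≤s ())
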